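{- Let $G$ be a graph with $\Delta(G)=\mathrm{n}(G)-1$ and let $H$ be any graph. Then $\xi(G\odot H)=\mathrm{n}(G)$ if $\delta(G)\ge 2$, and $\xi(G\odot H)=\mathrm{n}(H)+\mathrm{n}(G)-1$ if $\delta(G)=1$.
   Context: All graphs are finite, simple and undirected; $\mathrm{n}(G)$ denotes the order of $G$, $\Delta(G)$ its maximum degree and $\delta(G)$ its minimum degree. For a connected graph $\Gamma$, a set $S\subseteq V(\Gamma)$ is a distance-equalizer set if for every two distinct $u,v\in V(\Gamma)\setminus S$ there is $w\in S$ with $d_\Gamma(w,u)=d_\Gamma(w,v)$; $\xi(\Gamma)$ is the minimum cardinality of such a set. For $V(G)=\{v_1,\dots,v_n\}$, the corona product $G\odot H$ is obtained from $G$ and $n$ pairwise disjoint copies $H_1,\dots,H_n$ of $H$ by joining $v_i$ to every vertex of $H_i$. -}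

module Defs where

open import Data.Nat using (ℕ; zero; suc; _+_; _*_; _∸_; _≤_; _<_; _⊔_; _⊓_)
open import Data.Bool using (Bool; true; false; if_then_else_; _∧_)
open import Data.Fin using (Fin; splitAt; remQuot)
open import Data.Fin.Properties using (_≟_)
open import Data.Fin.Subset using (Subset; _∈_; _∉_; ∣_∣)
open import Data.List using (List; map; foldr; allFin)
open import Data.Nat.ListAction using (sum)
open import Data.Sum using (_⊎_; inj₁; inj₂)
open import Data.Product using (_×_; _,_; ∃; ∃-syntax; Σ-syntax)
open import Relation.Nullary using (¬_; does)
open import Relation.Binary.PropositionalEquality using (_≡_; _≢_)

record Graph : Set where
  field
    n      : ℕ
    adj    : Fin n → Fin n → Bool
    sym    : ∀ u v → adj u v ≡ adj v u
    irrefl : ∀ v → adj v v ≡ false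
open Graph public

deg : (G : Graph) → Fin (n G) → ℕ
deg G v = sum (map (λ u → if adj G v u then 1 else 0) (allFin (n G)))

-- maximum degree Δ(G) (0 for the empty graph)
maxDeg : Graph → ℕ
maxDeg G = foldr _⊔_ 0 (map (deg G) (allFin (n G)))

-- minimum degree δ(G); the seed n(G) exceeds every degree, so for
-- nonempty G this is exactly the minimum of the degrees
minDeg : Graph → ℕ
minDeg G = foldr _⊓_ (n G) (map (deg G) (allFin (n G)))

data Walk {N : ℕ} (a : Fin N → Fin N → Bool) : ℕ → Fin N → Fin N → Set where
  here : ∀ {u} → Walk a 0 u u
  step : ∀ {k u w v} → a u w ≡ true → Walk a k w v → Walk a (suc k) u v

Dist : {N : ℕ} → (Fin N → Fin N → Bool) → Fin N → Fin N → ℕ → Set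
Dist a u v d = Walk a d u v × (∀ k → k < d → ¬ Walk a k u v)

IsDistEqualizer : {N : ℕ} → (Fin N → Fin N → Bool) → Subset N → Set
IsDistEqualizer {N} a S =
  ∀ (u v : Fin N) → u ≢ v → u ∉ S → v ∉ S →
    ∃[ w ] (w ∈ S × ∃[ d ] (Dist a w u d × Dist a w v d))

IsXi : {N : ℕ} → (Fin N → Fin N → Bool) → ℕ → Set
IsXi {N} a k =
  (∃[ S ] (IsDistEqualizer a S × ∣ S ∣ ≡ k)) ×
  (∀ (S : Subset N) → IsDistEqualizer a S → k ≤ ∣ S ∣)

-- Corona product G ⊙ H. Vertex set: Fin n(G) ⊎ (Fin n(G) × Fin n(H)),
-- where inj₁ i = v_i and inj₂ (i , j) = vertex j of the copy H_i;
-- encoded as Fin (n(G) + n(G) * n(H)).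
CoronaV : Graph → Graph → Set
CoronaV G H = Fin (n G) ⊎ (Fin (n G) × Fin (n H))

coronaAdj' : (G H : Graph) → CoronaV G H → CoronaV G H → Bool
coronaAdj' G H (inj₁ i) (inj₁ i') = adj G i i'
coronaAdj' G H (inj₁ i) (inj₂ (i' , _)) = does (i ≟ i')
coronaAdj' G H (inj₂ (i , _)) (inj₁ i') = does (i ≟ i')
coronaAdj' G H (inj₂ (i , j)) (inj₂ (i' , j')) = does (i ≟ i') ∧ adj H j j'

coronaN : Graph → Graph → ℕ
coronaN G H = n G + n G * n H

decodeCorona : (G H : Graph) → Fin (coronaN G H) → CoronaV G H
decodeCorona G H x with splitAt (n G) x
... | inj₁ i = inj₁ i
... | inj₂ y = inj₂ (remQuot (n H) y)

corona : (G H : Graph) → Fin (coronaN G H) → Fin (coronaN G H) → Bool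
corona G H x y = coronaAdj' G H (decodeCorona G H x) (decodeCorona G H y)

-- Since Δ(G) = n(G) - 1, G has a universal vertex u, so distances in G are 0, 1 or 2 and every
-- distance in G ⊙ H is given by an explicit formula, certified by explicit walks and by a
-- 1-Lipschitz potential. Call {v_i} ∪ V(H_i) the i-th block. A distance-equalizer S meets
-- every block, because only vertices of block i are equidistant from v_i and a vertex of H_i;
-- hence ξ ≥ n(G). If δ(G) ≥ 2, any two vertices of G have an equidistant vertex, so V(G) is a
-- distance-equalizer. If δ(G) = 1, there is a leaf ℓ ≠ u adjacent only to u, and no vertex is
-- equidistant from a vertex of H_u and a vertex of H_ℓ; so S contains all of H_u or all of H_ℓ,
-- which together with one vertex of each other block gives ξ ≥ n(H) + n(G) - 1, attained by
-- (V(G) - u) ∪ V(H_u).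
module Submission where

open import Defs hiding (sym)
open import Data.Bool using (Bool; true; false; if_then_else_)
open import Data.Bool.Properties using (not-¬; ¬-not)
open import Data.Fin as Fin using (Fin; zero; suc; punchIn; splitAt; _↑ˡ_; _↑ʳ_; combine)
open import Data.Fin.Properties as Finₚ using (_≟_)
open import Data.Fin.Subset using (Subset; _∈_; _∉_; ∣_∣; _-_; ∁; ⁅_⁆; ⊤; ⊥; Nonempty; _⊆_)
open import Data.Fin.Subset.Properties
open import Data.List as List using (map; allFin)
open import Data.List.Membership.Propositional using () renaming (_∈_ to _∈ˡ_)
open import Data.List.Membership.Propositional.Properties using (∈-allFin; ∈-map⁺; ∈-map⁻; foldr-selective)
open import Data.List.Properties using (foldr-preservesᵒ; map-tabulate)
open import Data.List.Relation.Unary.Any as Any using ()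
open import Data.Nat using (ℕ; zero; suc; _+_; _*_; _∸_; _≤_; _<_; _⊔_; _⊓_; z≤n; s≤s; >-nonZero⁻¹)
open import Data.Nat.ListAction using (sum)
open import Data.Nat.Properties hiding (_≟_)
open import Data.Product using (_×_; _,_; ∃-syntax; proj₁; proj₂; map₂)
open import Data.Product.Properties using (,-injectiveʳ)
open import Data.Sum using (_⊎_; inj₁; inj₂; [_,_]′)
open import Data.Sum.Properties using (inj₂-injective)
open import Data.Vec as Vec using ([]; _∷_; _++_; concat; lookup; tabulate)
import Data.Vec.Properties as Vecₚ
open import Function using (_∘_; _⇔_; mk⇔; Equivalence; _↔_; mk↔ₛ′; Inverse; Injection)
open import Function.Definitions using (Injective)
open import Function.Properties.Inverse using (↔⇒↣; ↔-sym)
open import Relation.Nullary using (Dec; yes; no; does; contradiction; _×-dec_; ¬?)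
open import Relation.Nullary.Decidable using (dec-true; dec-false)
open import Relation.Binary.PropositionalEquality
  using (_≡_; _≢_; refl; sym; trans; cong; cong₂; subst; subst₂; ≢-sym; module ≡-Reasoning)

module _ {N : ℕ} where

  injective⇒≤∣p∣ : ∀ {k} (p : Subset N) (f : Fin k → Fin N) →
    Injective _≡_ _≡_ f → (∀ i → f i ∈ p) → k ≤ ∣ p ∣
  injective⇒≤∣p∣ {zero} _ _ _ _ = z≤n
  injective⇒≤∣p∣ {suc k} p f f-inj f∈p =
    ≤-trans (s≤s (injective⇒≤∣p∣ (p - f zero) (f ∘ suc) (Finₚ.suc-injective ∘ f-inj) f∘suc∈p-f0))
            (x∈p⇒∣p-x∣<∣p∣ (f∈p zero))
    where
    f∘suc∈p-f0 : ∀ i → f (suc i) ∈ p - f zero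
    f∘suc∈p-f0 i = x∈p∧x≢y⇒x∈p-y (f∈p (suc i)) (λ eq → Finₚ.0≢1+n (sym (f-inj eq)))

  disjoint-injectives⇒≤∣p∣ : ∀ {k l} (p : Subset N) (f : Fin k → Fin N) (g : Fin l → Fin N) →
    Injective _≡_ _≡_ f → Injective _≡_ _≡_ g → (∀ i j → f i ≢ g j) →
    (∀ i → f i ∈ p) → (∀ j → g j ∈ p) → k + l ≤ ∣ p ∣
  disjoint-injectives⇒≤∣p∣ {k} {l} p f g f-inj g-inj f≢g f∈p g∈p =
    injective⇒≤∣p∣ p ([ f , g ]′ ∘ splitAt k) (splitAt-injective ∘ [f,g]-injective) ([f,g]∈p ∘ splitAt k)
    where
    splitAt-injective : Injective _≡_ _≡_ (splitAt k {l})
    splitAt-injective = Injection.injective (↔⇒↣ Finₚ.+↔⊎)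
    [f,g]-injective : Injective _≡_ _≡_ [ f , g ]′
    [f,g]-injective {inj₁ i} {inj₁ i′} eq = cong inj₁ (f-inj eq)
    [f,g]-injective {inj₁ i} {inj₂ j} eq = contradiction eq (f≢g i j)
    [f,g]-injective {inj₂ j} {inj₁ i} eq = contradiction (sym eq) (f≢g i j)
    [f,g]-injective {inj₂ j} {inj₂ j′} eq = cong inj₂ (g-inj eq)
    [f,g]∈p : ∀ s → [ f , g ]′ s ∈ p
    [f,g]∈p (inj₁ i) = f∈p i
    [f,g]∈p (inj₂ j) = g∈p j

  x∈p∧y∈p∧x≢y⇒1<∣p∣ : ∀ {p : Subset N} {x y} → x ∈ p → y ∈ p → x ≢ y → 1 < ∣ p ∣
  x∈p∧y∈p∧x≢y⇒1<∣p∣ {p} {x} {y} x∈p y∈p x≢y = injective⇒≤∣p∣ p f f-inj f∈p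
    where
    f : Fin 2 → Fin N
    f zero = x
    f (suc _) = y
    f-inj : Injective _≡_ _≡_ f
    f-inj {zero} {zero} _ = refl
    f-inj {zero} {suc zero} eq = contradiction eq x≢y
    f-inj {suc zero} {zero} eq = contradiction (sym eq) x≢y
    f-inj {suc zero} {suc zero} _ = refl
    f∈p : ∀ i → f i ∈ p
    f∈p zero = x∈p
    f∈p (suc _) = y∈p

  0<∣p∣⇒Nonempty : ∀ (p : Subset N) → 0 < ∣ p ∣ → Nonempty p
  0<∣p∣⇒Nonempty p 0<∣p∣ with nonempty? p
  ... | yes nonempty = nonempty
  ... | no empty = contradiction (trans (cong ∣_∣ (Empty-unique empty)) (∣⊥∣≡0 N)) (≢-sym (<⇒≢ 0<∣p∣))

  1<∣p∣⇒other-member : ∀ (p : Subset N) → 1 < ∣ p ∣ → ∀ y → ∃[ x ] (x ∈ p × x ≢ y)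
  1<∣p∣⇒other-member p 1<∣p∣ y with Finₚ.any? (λ x → x ∈? p ×-dec ¬? (x ≟ y))
  ... | yes found = found
  ... | no none =
    contradiction (≤-trans 1<∣p∣ (≤-trans (p⊆q⇒∣p∣≤∣q∣ p⊆⁅y⁆) (≤-reflexive (∣⁅x⁆∣≡1 y)))) (<-irrefl refl)
    where
    p⊆⁅y⁆ : p ⊆ ⁅ y ⁆
    p⊆⁅y⁆ {x} x∈p with x ≟ y
    ... | yes refl = x∈⁅x⁆ y
    ... | no x≢y = contradiction (x , x∈p , x≢y) none

∣p++q∣≡∣p∣+∣q∣ : ∀ {m k} (p : Subset m) (q : Subset k) → ∣ p ++ q ∣ ≡ ∣ p ∣ + ∣ q ∣
∣p++q∣≡∣p∣+∣q∣ [] q = refl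
∣p++q∣≡∣p∣+∣q∣ (true ∷ p) q = cong suc (∣p++q∣≡∣p∣+∣q∣ p q)
∣p++q∣≡∣p∣+∣q∣ (false ∷ p) q = ∣p++q∣≡∣p∣+∣q∣ p q

full-or-empty : ∀ {k} → Bool → Subset k
full-or-empty b = if b then ⊤ else ⊥

∣concat-full-or-empty∣ : ∀ {m k} (p : Subset m) → ∣ concat (Vec.map (full-or-empty {k}) p) ∣ ≡ ∣ p ∣ * k
∣concat-full-or-empty∣ [] = refl
∣concat-full-or-empty∣ {k = k} (true ∷ p) =
  trans (∣p++q∣≡∣p∣+∣q∣ (⊤ {k}) _) (cong₂ _+_ (∣⊤∣≡n k) (∣concat-full-or-empty∣ p))
∣concat-full-or-empty∣ {k = k} (false ∷ p) =
  trans (∣p++q∣≡∣p∣+∣q∣ (⊥ {k}) _) (cong₂ _+_ (∣⊥∣≡0 k) (∣concat-full-or-empty∣ p))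

lookup-full-or-empty : ∀ {k} b (x : Fin k) → lookup (full-or-empty b) x ≡ b
lookup-full-or-empty true x = Vecₚ.lookup-replicate x true
lookup-full-or-empty false x = Vecₚ.lookup-replicate x false

∈⇔∈-of-lookup≡ : ∀ {m k} {p : Subset m} {q : Subset k} {x y} → lookup p x ≡ lookup q y → x ∈ p ⇔ y ∈ q
∈⇔∈-of-lookup≡ {p = p} {q} {x} {y} eq = mk⇔
  (λ x∈p → Vecₚ.lookup⇒[]= y q (trans (sym eq) (Vecₚ.[]=⇒lookup x∈p)))
  (λ y∈q → Vecₚ.lookup⇒[]= x p (trans eq (Vecₚ.[]=⇒lookup y∈q)))

punchIn-avoiding : ∀ {n} (c : Fin n) → ∃[ g ] (Injective _≡_ _≡_ g × ∀ (j : Fin (n ∸ 1)) → g j ≢ c)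
punchIn-avoiding {suc n} c = punchIn c , (λ {j} {k} → Finₚ.punchIn-injective c j k) , Finₚ.punchInᵢ≢i c

sum-indicators≡∣tabulate∣ : ∀ {n} (f : Fin n → Bool) →
  sum (List.tabulate (λ j → if f j then 1 else 0)) ≡ ∣ tabulate f ∣
sum-indicators≡∣tabulate∣ {zero} f = refl
sum-indicators≡∣tabulate∣ {suc n} f with f zero
... | true = cong suc (sum-indicators≡∣tabulate∣ (f ∘ suc))
... | false = sum-indicators≡∣tabulate∣ (f ∘ suc)

IsUniversal : (G : Graph) → Fin (n G) → Set
IsUniversal G u = ∀ j → j ≢ u → adj G u j ≡ true

module _ (G : Graph) where

  neighbours : Fin (n G) → Subset (n G)
  neighbours v = tabulate (adj G v)

  deg≡∣neighbours∣ : ∀ v → deg G v ≡ ∣ neighbours v ∣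
  deg≡∣neighbours∣ v =
    trans (cong sum (map-tabulate {n = n G} (λ j → j) (λ j → if adj G v j then 1 else 0)))
          (sum-indicators≡∣tabulate∣ (adj G v))

  ∈-neighbours : ∀ {v j} → j ∈ neighbours v ⇔ adj G v j ≡ true
  ∈-neighbours {v} {j} = mk⇔
    (λ j∈ → trans (sym (Vecₚ.lookup∘tabulate (adj G v) j)) (Vecₚ.[]=⇒lookup j∈))
    (λ adj≡ → Vecₚ.lookup⇒[]= j (neighbours v) (trans (Vecₚ.lookup∘tabulate (adj G v) j) adj≡))

  ∉-neighbours : ∀ {v j} → adj G v j ≡ false → j ∉ neighbours v
  ∉-neighbours adj≡false = not-¬ adj≡false ∘ Equivalence.to ∈-neighbours

  deg≡n∸1⇒universal : ∀ {v} → deg G v ≡ n G ∸ 1 → IsUniversal G v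
  deg≡n∸1⇒universal {v} deg≡ j j≢v with adj G v j in adj≡
  ... | true = refl
  ... | false = contradiction (≤-trans 1<∣∁N∣ (≤-reflexive ∣∁N∣≡1)) (<-irrefl refl)
    where
    1<∣∁N∣ : 1 < ∣ ∁ (neighbours v) ∣
    1<∣∁N∣ = x∈p∧y∈p∧x≢y⇒1<∣p∣ (x∉p⇒x∈∁p (∉-neighbours (irrefl G v))) (x∉p⇒x∈∁p (∉-neighbours adj≡))
                                 (≢-sym j≢v)
    ∣∁N∣≡1 : ∣ ∁ (neighbours v) ∣ ≡ 1
    ∣∁N∣≡1 = begin
      ∣ ∁ (neighbours v) ∣       ≡⟨ ∣∁p∣≡n∸∣p∣ (neighbours v) ⟩
      n G ∸ ∣ neighbours v ∣     ≡⟨ cong (n G ∸_) (trans (sym (deg≡∣neighbours∣ v)) deg≡) ⟩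
      n G ∸ (n G ∸ 1)            ≡⟨ m∸[m∸n]≡n (>-nonZero⁻¹ (n G) {{Finₚ.nonZeroIndex v}}) ⟩
      1                          ∎
      where open ≡-Reasoning

  deg≤1⇒unique-neighbour : ∀ {v i j} → deg G v ≤ 1 → adj G v i ≡ true → adj G v j ≡ true → i ≡ j
  deg≤1⇒unique-neighbour {v} {i} {j} deg≤1 adj-i adj-j with i ≟ j
  ... | yes i≡j = i≡j
  ... | no i≢j = contradiction (≤-trans 1<deg deg≤1) (<-irrefl refl)
    where
    1<deg : 1 < deg G v
    1<deg = subst (1 <_) (sym (deg≡∣neighbours∣ v))
      (x∈p∧y∈p∧x≢y⇒1<∣p∣ (Equivalence.from ∈-neighbours adj-i) (Equivalence.from ∈-neighbours adj-j) i≢j)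

  0<deg⇒neighbour : ∀ {v} → 0 < deg G v → ∃[ j ] adj G v j ≡ true
  0<deg⇒neighbour {v} 0<deg with 0<∣p∣⇒Nonempty (neighbours v) (subst (0 <_) (deg≡∣neighbours∣ v) 0<deg)
  ... | j , j∈ = j , Equivalence.to ∈-neighbours j∈

  1<deg⇒other-neighbour : ∀ {v} → 1 < deg G v → ∀ u → ∃[ j ] (j ≢ u × adj G v j ≡ true)
  1<deg⇒other-neighbour {v} 1<deg u with 1<∣p∣⇒other-member (neighbours v) (subst (1 <_) (deg≡∣neighbours∣ v) 1<deg) u
  ... | j , j∈ , j≢u = j , j≢u , Equivalence.to ∈-neighbours j∈

  deg<n : ∀ v → deg G v < n G
  deg<n v = begin-strict
    deg G v              ≡⟨ deg≡∣neighbours∣ v ⟩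
    ∣ neighbours v ∣     <⟨ p⊂q⇒∣p∣<∣q∣ ((λ _ → ∈⊤) , v , ∈⊤ , ∉-neighbours (irrefl G v)) ⟩
    ∣ ⊤ {n G} ∣          ≡⟨ ∣⊤∣≡n (n G) ⟩
    n G                  ∎
    where open ≤-Reasoning

  private
    ≤-⊔ : ∀ {k} x y → k ≤ x ⊎ k ≤ y → k ≤ x ⊔ y
    ≤-⊔ x y = [ m≤n⇒m≤n⊔o y , m≤n⇒m≤o⊔n x ]′

    ⊓-≤ : ∀ {k} x y → x ≤ k ⊎ y ≤ k → x ⊓ y ≤ k
    ⊓-≤ x y = [ m≤n⇒m⊓o≤n y , m≤n⇒o⊓m≤n x ]′

    deg∈degrees : ∀ v → deg G v ∈ˡ map (deg G) (allFin (n G))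
    deg∈degrees v = ∈-map⁺ (deg G) (∈-allFin v)

  deg≤maxDeg : ∀ v → deg G v ≤ maxDeg G
  deg≤maxDeg v = foldr-preservesᵒ ≤-⊔ 0 _ (inj₂ (Any.map ≤-reflexive (deg∈degrees v)))

  minDeg≤deg : ∀ v → minDeg G ≤ deg G v
  minDeg≤deg v = foldr-preservesᵒ ⊓-≤ (n G) _ (inj₂ (Any.map (≤-reflexive ∘ sym) (deg∈degrees v)))

  minDeg≤n : minDeg G ≤ n G
  minDeg≤n = foldr-preservesᵒ ⊓-≤ (n G) (map (deg G) (allFin (n G))) (inj₁ ≤-refl)

  vertex-of-0<minDeg : 0 < minDeg G → Fin (n G)
  vertex-of-0<minDeg 0<δ = Fin.fromℕ< (≤-trans 0<δ minDeg≤n)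

  maxDeg-attained : Fin (n G) → ∃[ v ] deg G v ≡ maxDeg G
  maxDeg-attained v₀ with foldr-selective ⊔-sel 0 (map (deg G) (allFin (n G)))
  ... | inj₁ Δ≡0 = v₀ , trans (n≤0⇒n≡0 (subst (deg G v₀ ≤_) Δ≡0 (deg≤maxDeg v₀))) (sym Δ≡0)
  ... | inj₂ Δ∈ with ∈-map⁻ (deg G) Δ∈
  ...   | v , _ , Δ≡deg = v , sym Δ≡deg

  minDeg-attained : Fin (n G) → ∃[ v ] deg G v ≡ minDeg G
  minDeg-attained v₀ with foldr-selective ⊓-sel (n G) (map (deg G) (allFin (n G)))
  ... | inj₁ δ≡n = contradiction (≤-<-trans (subst (_≤ deg G v₀) δ≡n (minDeg≤deg v₀)) (deg<n v₀)) (<-irrefl refl)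
  ... | inj₂ δ∈ with ∈-map⁻ (deg G) δ∈
  ...   | v , _ , δ≡deg = v , sym δ≡deg

  maxDeg≡n∸1⇒universal-vertex : Fin (n G) → maxDeg G ≡ n G ∸ 1 →
    ∃[ u ] (IsUniversal G u × ∀ v → deg G v ≤ deg G u)
  maxDeg≡n∸1⇒universal-vertex v₀ Δ≡n∸1 with maxDeg-attained v₀
  ... | u , deg≡Δ =
    u , deg≡n∸1⇒universal (trans deg≡Δ Δ≡n∸1) , λ v → subst (deg G v ≤_) (sym deg≡Δ) (deg≤maxDeg v)

  universal⇒adjacent : ∀ {u j} → IsUniversal G u → j ≢ u → adj G j u ≡ true
  universal⇒adjacent {u} {j} u-universal j≢u = trans (Graph.sym G j u) (u-universal j j≢u)

  leaf-beside-universal : ∀ {u ℓ₀} → IsUniversal G u → (∀ v → deg G v ≤ deg G u) → deg G ℓ₀ ≡ 1 →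
    ∃[ ℓ ] (ℓ ≢ u × ∀ j → adj G ℓ j ≡ true → j ≡ u)
  leaf-beside-universal {u} {ℓ₀} u-universal u-maximal deg≡1 with ℓ₀ ≟ u
  ... | no ℓ₀≢u = ℓ₀ , ℓ₀≢u , λ j adj-j →
    deg≤1⇒unique-neighbour (≤-reflexive deg≡1) adj-j (universal⇒adjacent u-universal ℓ₀≢u)
  -- If the vertex of degree 1 is u itself, then G is K₂ and its other vertex is the leaf.
  ... | yes refl with 0<deg⇒neighbour (≤-reflexive (sym deg≡1))
  ... | p , adj-up = p , p≢u , λ j adj-j →
    deg≤1⇒unique-neighbour (≤-trans (u-maximal p) (≤-reflexive deg≡1)) adj-j (trans (Graph.sym G p u) adj-up)
    where
    p≢u : p ≢ u
    p≢u refl = not-¬ (irrefl G p) adj-up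

EqualizesVia : ∀ {V : Set} {N} → V ↔ Fin N → (V → V → ℕ) → Subset N → Set
EqualizesVia ι δ S = ∀ p q → p ≢ q → to p ∉ S → to q ∉ S → ∃[ w ] (to w ∈ S × δ w p ≡ δ w q)
  where open Inverse ι

module _ {N : ℕ} {a : Fin N → Fin N → Bool} where

  Lipschitz : (Fin N → ℕ) → Set
  Lipschitz φ = ∀ x y → a x y ≡ true → φ y ≤ suc (φ x)

  walk-length≥potential : ∀ {φ} → Lipschitz φ → ∀ {k x y} → Walk a k x y → φ y ≤ k + φ x
  walk-length≥potential φ-lip here = ≤-refl
  walk-length≥potential {φ} φ-lip (step {k} {x} {w} {y} axw walk) = begin
    φ y             ≤⟨ walk-length≥potential φ-lip walk ⟩
    k + φ w         ≤⟨ +-monoʳ-≤ k (φ-lip x w axw) ⟩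
    k + suc (φ x)   ≡⟨ +-suc k (φ x) ⟩
    suc k + φ x     ∎
    where open ≤-Reasoning

  potential⇒Dist : ∀ {x} (ρ : Fin N → ℕ) → ρ x ≡ 0 → Lipschitz ρ → (∀ y → Walk a (ρ y) x y) →
    ∀ y → Dist a x y (ρ y)
  potential⇒Dist ρ ρx≡0 ρ-lip walk y = walk y , λ k k<ρy shorter →
    <⇒≱ k<ρy (subst (ρ y ≤_) (trans (cong (k +_) ρx≡0) (+-identityʳ k)) (walk-length≥potential ρ-lip shorter))

  Dist-unique : ∀ {x y d d′} → Dist a x y d → Dist a x y d′ → d ≡ d′
  Dist-unique (walk , minimal) (walk′ , minimal′) =
    ≤-antisym (≮⇒≥ (λ d′<d → minimal _ d′<d walk′)) (≮⇒≥ (λ d<d′ → minimal′ _ d<d′ walk))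

  snoc : ∀ {k x y z} → Walk a k x y → a y z ≡ true → Walk a (suc k) x z
  snoc here ayz = step ayz here
  snoc (step axw walk) ayz = step axw (snoc walk ayz)

  module _ {V : Set} (ι : V ↔ Fin N) (δ : V → V → ℕ)
           (δ-exact : ∀ p q → Dist a (Inverse.to ι p) (Inverse.to ι q) (δ p q)) where
    open Inverse ι

    private
      to-injective : Injective _≡_ _≡_ to
      to-injective = Injection.injective (↔⇒↣ ι)

      from-injective : Injective _≡_ _≡_ from
      from-injective = Injection.injective (↔⇒↣ (↔-sym ι))

      Dist-from : ∀ x z → Dist a x (to z) (δ (from x) z)
      Dist-from x z = subst (λ t → Dist a t (to z) _) (strictlyInverseˡ x) (δ-exact (from x) z)

      Dist-to : ∀ w y → Dist a (to w) y (δ w (from y))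
      Dist-to w y = subst (λ t → Dist a (to w) t _) (strictlyInverseˡ y) (δ-exact w (from y))

      ∉-to-from : ∀ {S x} → x ∉ S → to (from x) ∉ S
      ∉-to-from {S} {x} x∉S = x∉S ∘ subst (_∈ S) (strictlyInverseˡ x)

    IsDistEqualizer⇔ : ∀ S → IsDistEqualizer a S ⇔ EqualizesVia ι δ S
    IsDistEqualizer⇔ S = mk⇔ forth back
      where
      forth : IsDistEqualizer a S → EqualizesVia ι δ S
      forth equalizer p q p≢q p∉S q∉S with equalizer (to p) (to q) (p≢q ∘ to-injective) p∉S q∉S
      ... | x , x∈S , d , dist-p , dist-q =
        from x , subst (_∈ S) (sym (strictlyInverseˡ x)) x∈S ,
        trans (Dist-unique (Dist-from x p) dist-p) (Dist-unique dist-q (Dist-from x q))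
      back : EqualizesVia ι δ S → IsDistEqualizer a S
      back equalizes x y x≢y x∉S y∉S
        with equalizes (from x) (from y) (x≢y ∘ from-injective) (∉-to-from x∉S) (∉-to-from y∉S)
      ... | w , w∈S , δ≡ = to w , w∈S , δ w (from x) , Dist-to w x , subst (Dist a (to w) y) (sym δ≡) (Dist-to w y)

-- The distance in the cone over X (X plus an apex adjacent to all of X). It is the distance of X
-- when X has a universal vertex, and the distance within a copy of X in a corona.
coneDist : (X : Graph) → Fin (n X) → Fin (n X) → ℕ
coneDist X i j = if does (i ≟ j) then 0 else if adj X i j then 1 else 2

module _ (X : Graph) where

  coneDist-self : ∀ i → coneDist X i i ≡ 0
  coneDist-self i rewrite dec-true (i ≟ i) refl = refl

  coneDist≤2 : ∀ i j → coneDist X i j ≤ 2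
  coneDist≤2 i j with does (i ≟ j) | adj X i j
  ... | true  | _     = z≤n
  ... | false | true  = s≤s z≤n
  ... | false | false = ≤-refl

  coneDist-adjacent : ∀ {i j} → adj X i j ≡ true → coneDist X i j ≡ 1
  coneDist-adjacent {i} {j} adj≡ with i ≟ j
  ... | yes refl = contradiction adj≡ (not-¬ (irrefl X i))
  ... | no _ rewrite adj≡ = refl

  coneDist-nonadjacent : ∀ {i j} → i ≢ j → adj X i j ≡ false → coneDist X i j ≡ 2
  coneDist-nonadjacent {i} {j} i≢j adj≡ rewrite dec-false (i ≟ j) i≢j | adj≡ = refl

  coneDist-pos : ∀ {i j} → i ≢ j → 0 < coneDist X i j
  coneDist-pos {i} {j} i≢j rewrite dec-false (i ≟ j) i≢j with adj X i j
  ... | true  = s≤s z≤n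
  ... | false = s≤s z≤n

  coneDist-lipschitz : ∀ i {j k} → adj X j k ≡ true → coneDist X i k ≤ suc (coneDist X i j)
  coneDist-lipschitz i {j} {k} adj≡ = lipschitz (i ≟ j)
    where
    lipschitz : Dec (i ≡ j) → coneDist X i k ≤ suc (coneDist X i j)
    lipschitz (yes refl) = ≤-trans (≤-reflexive (coneDist-adjacent adj≡)) (s≤s z≤n)
    lipschitz (no i≢j) = ≤-trans (coneDist≤2 i k) (s≤s (coneDist-pos i≢j))

  coneDist-walk : ∀ {N} {a : Fin N → Fin N → Bool} (e : Fin (n X) → Fin N) →
    (∀ {i j} → adj X i j ≡ true → a (e i) (e j) ≡ true) →
    (∀ {i j} → i ≢ j → adj X i j ≡ false → Walk a 2 (e i) (e j)) →
    ∀ i j → Walk a (coneDist X i j) (e i) (e j)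
  coneDist-walk e edge detour i j with i ≟ j
  ... | yes refl = here
  ... | no i≢j with adj X i j in adj≡
  ...   | true = step (edge adj≡) here
  ...   | false = detour i≢j adj≡

  module _ {u : Fin (n X)} (u-universal : IsUniversal X u) where

    private
      coneDist-to-u : ∀ {j} → j ≢ u → coneDist X j u ≡ 1
      coneDist-to-u j≢u = coneDist-adjacent (universal⇒adjacent X u-universal j≢u)

      equidistant-from-u : ∀ {j} → 1 < deg X j → j ≢ u → ∃[ k ] coneDist X k u ≡ coneDist X k j
      equidistant-from-u {j} 1<deg j≢u with 1<deg⇒other-neighbour X 1<deg u
      ... | k , k≢u , j~k = k , trans (coneDist-to-u k≢u) (sym (coneDist-adjacent (trans (Graph.sym X k j) j~k)))

    equidistant-vertex : (∀ v → 1 < deg X v) → ∀ i j → ∃[ k ] coneDist X k i ≡ coneDist X k j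
    equidistant-vertex 1<deg i j with i ≟ u | j ≟ u
    ... | yes refl | yes refl = u , refl
    ... | yes refl | no j≢u = equidistant-from-u (1<deg j) j≢u
    ... | no i≢u | yes refl = map₂ sym (equidistant-from-u (1<deg i) i≢u)
    ... | no i≢u | no j≢u = u , trans (coneDist-adjacent (u-universal i i≢u)) (sym (coneDist-adjacent (u-universal j j≢u)))

    leaf-separates : ∀ {ℓ} → ℓ ≢ u → (∀ j → adj X ℓ j ≡ true → j ≡ u) →
      ∀ j → coneDist X j u ≢ coneDist X j ℓ
    leaf-separates {ℓ} ℓ≢u ℓ-leaf j = separated (j ≟ u) (j ≟ ℓ)
      where
      separated : Dec (j ≡ u) → Dec (j ≡ ℓ) → coneDist X j u ≢ coneDist X j ℓ
      separated (yes refl) _ eq =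
        contradiction (trans (sym (coneDist-self u)) (trans eq (coneDist-adjacent (u-universal ℓ ℓ≢u)))) λ ()
      separated (no j≢u) (yes refl) eq =
        contradiction (trans (sym (coneDist-to-u j≢u)) (trans eq (coneDist-self j))) λ ()
      separated (no j≢u) (no j≢ℓ) eq =
        contradiction (trans (sym (coneDist-to-u j≢u)) (trans eq (coneDist-nonadjacent j≢ℓ ¬j~ℓ))) λ ()
        where
        ¬j~ℓ : adj X j ℓ ≡ false
        ¬j~ℓ = ¬-not (λ j~ℓ → j≢u (ℓ-leaf j (trans (Graph.sym X ℓ j) j~ℓ)))

module Corona (G H : Graph) where

  V : Set
  V = CoronaV G H

  N : ℕ
  N = coronaN G H

  enc : V → Fin N
  enc (inj₁ i) = i ↑ˡ (n G * n H)
  enc (inj₂ (i , h)) = n G ↑ʳ combine i h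

  dec-enc : ∀ p → decodeCorona G H (enc p) ≡ p
  dec-enc (inj₁ i) rewrite Finₚ.splitAt-↑ˡ (n G) i (n G * n H) = refl
  dec-enc (inj₂ (i , h)) rewrite Finₚ.splitAt-↑ʳ (n G) (n G * n H) (combine i h)
                               | Finₚ.remQuot-combine {n G} {n H} i h = refl

  enc-dec : ∀ x → enc (decodeCorona G H x) ≡ x
  enc-dec x with splitAt (n G) x | Finₚ.join-splitAt (n G) (n G * n H) x
  ... | inj₁ i | i↑ˡ≡x = i↑ˡ≡x
  ... | inj₂ y | y↑ʳ≡x = trans (cong (n G ↑ʳ_) (Finₚ.combine-remQuot {n G} (n H) y)) y↑ʳ≡x

  vertices : V ↔ Fin N
  vertices = mk↔ₛ′ enc (decodeCorona G H) enc-dec dec-enc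

  enc-injective : Injective _≡_ _≡_ enc
  enc-injective = Injection.injective (↔⇒↣ vertices)

  _~_ : V → V → Set
  p ~ q = coronaAdj' G H p q ≡ true

  ~⇒adjacent : ∀ p q → p ~ q → corona G H (enc p) (enc q) ≡ true
  ~⇒adjacent p q = subst₂ _~_ (sym (dec-enc p)) (sym (dec-enc q))

  hub→copy : ∀ i h → corona G H (enc (inj₁ i)) (enc (inj₂ (i , h))) ≡ true
  hub→copy i h = ~⇒adjacent (inj₁ i) (inj₂ (i , h)) (dec-true (i ≟ i) refl)

  copy→hub : ∀ i h → corona G H (enc (inj₂ (i , h))) (enc (inj₁ i)) ≡ true
  copy→hub i h = ~⇒adjacent (inj₂ (i , h)) (inj₁ i) (dec-true (i ≟ i) refl)

  block : V → Fin (n G)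
  block (inj₁ i) = i
  block (inj₂ (i , _)) = i

  coronaDist : V → V → ℕ
  coronaDist (inj₁ i) (inj₁ j) = coneDist G i j
  coronaDist (inj₁ i) (inj₂ (j , _)) = suc (coneDist G i j)
  coronaDist (inj₂ (i , _)) (inj₁ j) = suc (coneDist G i j)
  coronaDist (inj₂ (i , h)) (inj₂ (j , h′)) = if does (i ≟ j) then coneDist H h h′ else 2 + coneDist G i j

  coronaDist-same-copy : ∀ i h h′ → coronaDist (inj₂ (i , h)) (inj₂ (i , h′)) ≡ coneDist H h h′
  coronaDist-same-copy i h h′ rewrite dec-true (i ≟ i) refl = refl

  coronaDist-other-copy : ∀ {i j} h h′ → i ≢ j → coronaDist (inj₂ (i , h)) (inj₂ (j , h′)) ≡ 2 + coneDist G i j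
  coronaDist-other-copy {i} {j} h h′ i≢j rewrite dec-false (i ≟ j) i≢j = refl

  coronaDist-self : ∀ w → coronaDist w w ≡ 0
  coronaDist-self (inj₁ i) = coneDist-self G i
  coronaDist-self (inj₂ (i , h)) = trans (coronaDist-same-copy i h h) (coneDist-self H h)

  coronaDist-lipschitz : ∀ w {p q} → p ~ q → coronaDist w q ≤ suc (coronaDist w p)
  coronaDist-lipschitz (inj₁ i) {inj₁ j} {inj₁ k} j~k = coneDist-lipschitz G i j~k
  coronaDist-lipschitz (inj₁ i) {inj₁ j} {inj₂ (k , _)} j~k with j ≟ k
  ... | yes refl = ≤-refl
  coronaDist-lipschitz (inj₁ i) {inj₂ (j , _)} {inj₁ k} j~k with j ≟ k
  ... | yes refl = m≤n+m _ 2
  coronaDist-lipschitz (inj₁ i) {inj₂ (j , _)} {inj₂ (k , _)} j~k with j ≟ k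
  ... | yes refl = n≤1+n _
  coronaDist-lipschitz (inj₂ (i , h)) {inj₁ j} {inj₁ k} j~k = s≤s (coneDist-lipschitz G i j~k)
  coronaDist-lipschitz (inj₂ (i , h)) {inj₁ j} {inj₂ (k , h′)} j~k with j ≟ k
  ... | yes refl with i ≟ j
  ...   | yes refl = coneDist≤2 H h h′
  ...   | no _ = ≤-refl
  coronaDist-lipschitz (inj₂ (i , h)) {inj₂ (j , h′)} {inj₁ k} j~k with j ≟ k
  ... | yes refl with i ≟ j
  ...   | yes refl = s≤s z≤n
  ...   | no _ = m≤n+m _ 2
  coronaDist-lipschitz (inj₂ (i , h)) {inj₂ (j , h′)} {inj₂ (k , h″)} j~k with j ≟ k
  ... | yes refl with i ≟ j
  ...   | yes refl = coneDist-lipschitz H h j~k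
  ...   | no _ = n≤1+n _

  same-copy<other-copy : ∀ {i j} h h₁ h₂ → i ≢ j →
    coronaDist (inj₂ (i , h)) (inj₂ (i , h₁)) < coronaDist (inj₂ (i , h)) (inj₂ (j , h₂))
  same-copy<other-copy {i} {j} h h₁ h₂ i≢j = begin-strict
    coronaDist (inj₂ (i , h)) (inj₂ (i , h₁)) ≡⟨ coronaDist-same-copy i h h₁ ⟩
    coneDist H h h₁                           ≤⟨ coneDist≤2 H h h₁ ⟩
    2                                         <⟨ +-monoʳ-≤ 2 (coneDist-pos G i≢j) ⟩
    2 + coneDist G i j                        ≡⟨ coronaDist-other-copy h h₂ i≢j ⟨
    coronaDist (inj₂ (i , h)) (inj₂ (j , h₂)) ∎
    where open ≤-Reasoning

  hub-copy-equidistant⇒same-block : ∀ w {i h} → coronaDist w (inj₁ i) ≡ coronaDist w (inj₂ (i , h)) → block w ≡ i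
  hub-copy-equidistant⇒same-block (inj₁ j) eq = contradiction (sym eq) 1+n≢n
  hub-copy-equidistant⇒same-block (inj₂ (j , _)) {i} eq with j ≟ i
  ... | yes j≡i = j≡i
  ... | no _ = contradiction (sym (suc-injective eq)) 1+n≢n

  Equalizes : Subset N → Set
  Equalizes = EqualizesVia vertices coronaDist

  module _ {u : Fin (n G)} (u-universal : IsUniversal G u) where

    private
      a : Fin N → Fin N → Bool
      a = corona G H

      walk-in-G : ∀ i j → Walk a (coneDist G i j) (enc (inj₁ i)) (enc (inj₁ j))
      walk-in-G = coneDist-walk G (enc ∘ inj₁) (λ {i} {j} → ~⇒adjacent (inj₁ i) (inj₁ j)) via-u
        where
        via-u : ∀ {i j} → i ≢ j → adj G i j ≡ false → Walk a 2 (enc (inj₁ i)) (enc (inj₁ j))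
        via-u {i} {j} i≢j ¬i~j = step (~⇒adjacent (inj₁ i) (inj₁ u) (universal⇒adjacent G u-universal i≢u))
                                   (step (~⇒adjacent (inj₁ u) (inj₁ j) (u-universal j j≢u)) here)
          where
          i≢u : i ≢ u
          i≢u refl = not-¬ ¬i~j (u-universal j (≢-sym i≢j))
          j≢u : j ≢ u
          j≢u refl = not-¬ ¬i~j (universal⇒adjacent G u-universal i≢j)

      walk-in-copy : ∀ i h h′ → Walk a (coneDist H h h′) (enc (inj₂ (i , h))) (enc (inj₂ (i , h′)))
      walk-in-copy i = coneDist-walk H (enc ∘ inj₂ ∘ (i ,_))
        (λ {h} {h′} h~h′ → ~⇒adjacent (inj₂ (i , h)) (inj₂ (i , h′)) (within h~h′)) via-hub
        where
        within : ∀ {h h′} → adj H h h′ ≡ true → inj₂ (i , h) ~ inj₂ (i , h′)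
        within h~h′ rewrite dec-true (i ≟ i) refl = h~h′
        via-hub : ∀ {h h′} → h ≢ h′ → adj H h h′ ≡ false → Walk a 2 (enc (inj₂ (i , h))) (enc (inj₂ (i , h′)))
        via-hub {h} {h′} _ _ = step (copy→hub i h) (step (hub→copy i h′) here)

      coronaWalk : ∀ w z → Walk a (coronaDist w z) (enc w) (enc z)
      coronaWalk (inj₁ i) (inj₁ j) = walk-in-G i j
      coronaWalk (inj₁ i) (inj₂ (j , h)) = snoc (walk-in-G i j) (hub→copy j h)
      coronaWalk (inj₂ (i , h)) (inj₁ j) = step (copy→hub i h) (walk-in-G i j)
      coronaWalk (inj₂ (i , h)) (inj₂ (j , h′)) = copy-to-copy (i ≟ j)
        where
        copy-to-copy : Dec (i ≡ j) →
          Walk a (coronaDist (inj₂ (i , h)) (inj₂ (j , h′))) (enc (inj₂ (i , h))) (enc (inj₂ (j , h′)))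
        copy-to-copy (yes refl) = subst (λ d → Walk a d _ _) (sym (coronaDist-same-copy i h h′)) (walk-in-copy i h h′)
        copy-to-copy (no i≢j) = subst (λ d → Walk a d _ _) (sym (coronaDist-other-copy h h′ i≢j))
          (step (copy→hub i h) (snoc (walk-in-G i j) (hub→copy j h′)))

    coronaDist-exact : ∀ w z → Dist (corona G H) (enc w) (enc z) (coronaDist w z)
    coronaDist-exact w z = subst (Dist a (enc w) (enc z)) (cong (coronaDist w) (dec-enc z))
      (potential⇒Dist (coronaDist w ∘ decodeCorona G H) ρ-source (λ _ _ → coronaDist-lipschitz w) walk (enc z))
      where
      ρ-source : coronaDist w (decodeCorona G H (enc w)) ≡ 0
      ρ-source = trans (cong (coronaDist w) (dec-enc w)) (coronaDist-self w)
      walk : ∀ y → Walk a (coronaDist w (decodeCorona G H y)) (enc w) y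
      walk y = subst (Walk a _ (enc w)) (enc-dec y) (coronaWalk w (decodeCorona G H y))

    IsDistEqualizer⇔Equalizes : ∀ S → IsDistEqualizer (corona G H) S ⇔ Equalizes S
    IsDistEqualizer⇔Equalizes = IsDistEqualizer⇔ vertices coronaDist coronaDist-exact

  MeetsEveryBlock : Subset N → Set
  MeetsEveryBlock S = ∀ i → ∃[ w ] (enc w ∈ S × block w ≡ i)

  equalizer-meets-every-block : Fin (n H) → ∀ {S} → Equalizes S → MeetsEveryBlock S
  equalizer-meets-every-block h₀ {S} equalizes i with enc (inj₁ i) ∈? S
  ... | yes hub∈S = inj₁ i , hub∈S , refl
  ... | no hub∉S with enc (inj₂ (i , h₀)) ∈? S
  ...   | yes copy∈S = inj₂ (i , h₀) , copy∈S , refl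
  ...   | no copy∉S with equalizes (inj₁ i) (inj₂ (i , h₀)) (λ ()) hub∉S copy∉S
  ...     | w , w∈S , eq = w , w∈S , hub-copy-equidistant⇒same-block w eq

  module _ {S : Subset N} (meets : MeetsEveryBlock S) where

    private
      pick : Fin (n G) → V
      pick i = proj₁ (meets i)

      pick∈S : ∀ i → enc (pick i) ∈ S
      pick∈S i = proj₁ (proj₂ (meets i))

      block-pick : ∀ i → block (pick i) ≡ i
      block-pick i = proj₂ (proj₂ (meets i))

      enc-pick-injective : Injective _≡_ _≡_ (enc ∘ pick)
      enc-pick-injective {i} {j} eq =
        trans (sym (block-pick i)) (trans (cong block (enc-injective {pick i} {pick j} eq)) (block-pick j))

    meets-every-block⇒n≤∣S∣ : n G ≤ ∣ S ∣
    meets-every-block⇒n≤∣S∣ = injective⇒≤∣p∣ S (enc ∘ pick) enc-pick-injective pick∈S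

    meets-every-block∧copy⊆⇒≤∣S∣ : ∀ {c} → (∀ h → enc (inj₂ (c , h)) ∈ S) → n H + (n G ∸ 1) ≤ ∣ S ∣
    meets-every-block∧copy⊆⇒≤∣S∣ {c} copy⊆S with punchIn-avoiding c
    ... | skip , skip-injective , skip≢c =
      disjoint-injectives⇒≤∣p∣ S (enc ∘ inj₂ ∘ (c ,_)) (enc ∘ pick ∘ skip)
        (,-injectiveʳ ∘ inj₂-injective ∘ enc-injective) (skip-injective ∘ enc-pick-injective)
        (λ h j eq → skip≢c j (trans (sym (block-pick (skip j)))
                                    (cong block (sym (enc-injective {inj₂ (c , h)} {pick (skip j)} eq)))))
        copy⊆S (pick∈S ∘ skip)

  module _ {u : Fin (n G)} (u-universal : IsUniversal G u) {ℓ : Fin (n G)} (ℓ≢u : ℓ ≢ u)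
           (ℓ-leaf : ∀ j → adj G ℓ j ≡ true → j ≡ u) where

    leaf-copies-separated : ∀ w h h′ → coronaDist w (inj₂ (u , h)) ≢ coronaDist w (inj₂ (ℓ , h′))
    leaf-copies-separated (inj₁ j) _ _ = leaf-separates G u-universal ℓ≢u ℓ-leaf j ∘ suc-injective
    leaf-copies-separated (inj₂ (j , h″)) h h′ = separated (j ≟ u) (j ≟ ℓ)
      where
      separated : Dec (j ≡ u) → Dec (j ≡ ℓ) →
        coronaDist (inj₂ (j , h″)) (inj₂ (u , h)) ≢ coronaDist (inj₂ (j , h″)) (inj₂ (ℓ , h′))
      separated (yes refl) _ = <⇒≢ (same-copy<other-copy h″ h h′ (≢-sym ℓ≢u))
      separated (no _) (yes refl) = ≢-sym (<⇒≢ (same-copy<other-copy h″ h′ h ℓ≢u))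
      separated (no j≢u) (no j≢ℓ) eq = leaf-separates G u-universal ℓ≢u ℓ-leaf j (+-cancelˡ-≡ 2 _ _ (begin
        2 + coneDist G j u                             ≡⟨ coronaDist-other-copy h″ h j≢u ⟨
        coronaDist (inj₂ (j , h″)) (inj₂ (u , h))      ≡⟨ eq ⟩
        coronaDist (inj₂ (j , h″)) (inj₂ (ℓ , h′))     ≡⟨ coronaDist-other-copy h″ h′ j≢ℓ ⟩
        2 + coneDist G j ℓ                             ∎))
        where open ≡-Reasoning

    equalizer-contains-leaf-copy : ∀ {S} → Equalizes S →
      (∀ h → enc (inj₂ (u , h)) ∈ S) ⊎ (∀ h → enc (inj₂ (ℓ , h)) ∈ S)
    equalizer-contains-leaf-copy {S} equalizes with Finₚ.all? (λ h → enc (inj₂ (u , h)) ∈? S)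
    ... | yes u-copy⊆S = inj₁ u-copy⊆S
    ... | no u-copy⊈S with Finₚ.¬∀⟶∃¬ (n H) _ (λ h → enc (inj₂ (u , h)) ∈? S) u-copy⊈S
    ...   | h , uh∉S = inj₂ ℓ-copy⊆S
      where
      ℓ-copy⊆S : ∀ h′ → enc (inj₂ (ℓ , h′)) ∈ S
      ℓ-copy⊆S h′ with enc (inj₂ (ℓ , h′)) ∈? S
      ... | yes ℓh′∈S = ℓh′∈S
      ... | no ℓh′∉S with equalizes (inj₂ (u , h)) (inj₂ (ℓ , h′)) (ℓ≢u ∘ sym ∘ cong block) uh∉S ℓh′∉S
      ...   | w , _ , eq = contradiction eq (leaf-copies-separated w h h′)

  -- The set {v_i | i ∈ A} ∪ ⋃_{i ∈ B} V(H_i), laid out as the encoding of Defs.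
  coronaSubset : Subset (n G) → Subset (n G) → Subset N
  coronaSubset A B = A ++ concat (Vec.map full-or-empty B)

  ∣coronaSubset∣ : ∀ A B → ∣ coronaSubset A B ∣ ≡ ∣ A ∣ + ∣ B ∣ * n H
  ∣coronaSubset∣ A B = trans (∣p++q∣≡∣p∣+∣q∣ A _) (cong (∣ A ∣ +_) (∣concat-full-or-empty∣ B))

  hub∈coronaSubset⇔ : ∀ A B {i} → enc (inj₁ i) ∈ coronaSubset A B ⇔ i ∈ A
  hub∈coronaSubset⇔ A B {i} = ∈⇔∈-of-lookup≡ (Vecₚ.lookup-++ˡ A _ i)

  copy∈coronaSubset⇔ : ∀ A B {i h} → enc (inj₂ (i , h)) ∈ coronaSubset A B ⇔ i ∈ B
  copy∈coronaSubset⇔ A B {i} {h} = ∈⇔∈-of-lookup≡ (begin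
    lookup (coronaSubset A B) (n G ↑ʳ combine i h)          ≡⟨ Vecₚ.lookup-++ʳ A _ (combine i h) ⟩
    lookup (concat (Vec.map full-or-empty B)) (combine i h) ≡⟨ Vecₚ.lookup-concat (Vec.map full-or-empty B) i h ⟩
    lookup (lookup (Vec.map full-or-empty B) i) h           ≡⟨ cong (λ p → lookup p h) (Vecₚ.lookup-map i full-or-empty B) ⟩
    lookup (full-or-empty (lookup B i)) h                   ≡⟨ lookup-full-or-empty (lookup B i) h ⟩
    lookup B i                                              ∎)
    where open ≡-Reasoning

  allHubs : Subset N
  allHubs = coronaSubset ⊤ ⊥

  hub∈allHubs : ∀ {i} → enc (inj₁ i) ∈ allHubs
  hub∈allHubs = Equivalence.from (hub∈coronaSubset⇔ ⊤ ⊥) ∈⊤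

  ∣allHubs∣ : ∣ allHubs ∣ ≡ n G
  ∣allHubs∣ = begin
    ∣ allHubs ∣                    ≡⟨ ∣coronaSubset∣ ⊤ ⊥ ⟩
    ∣ ⊤ {n G} ∣ + ∣ ⊥ {n G} ∣ * n H ≡⟨ cong₂ (λ a b → a + b * n H) (∣⊤∣≡n (n G)) (∣⊥∣≡0 (n G)) ⟩
    n G + 0                        ≡⟨ +-identityʳ (n G) ⟩
    n G                            ∎
    where open ≡-Reasoning

  otherHubs∪copy : Fin (n G) → Subset N
  otherHubs∪copy u = coronaSubset (∁ ⁅ u ⁆) ⁅ u ⁆

  ∣otherHubs∪copy∣ : ∀ u → ∣ otherHubs∪copy u ∣ ≡ n H + (n G ∸ 1)
  ∣otherHubs∪copy∣ u = begin
    ∣ otherHubs∪copy u ∣            ≡⟨ ∣coronaSubset∣ (∁ ⁅ u ⁆) ⁅ u ⁆ ⟩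
    ∣ ∁ ⁅ u ⁆ ∣ + ∣ ⁅ u ⁆ ∣ * n H   ≡⟨ cong₂ (λ a b → a + b * n H) (∣∁p∣≡n∸∣p∣ ⁅ u ⁆) (∣⁅x⁆∣≡1 u) ⟩
    n G ∸ ∣ ⁅ u ⁆ ∣ + 1 * n H       ≡⟨ cong₂ (λ a b → n G ∸ a + b) (∣⁅x⁆∣≡1 u) (*-identityˡ (n H)) ⟩
    n G ∸ 1 + n H                   ≡⟨ +-comm (n G ∸ 1) (n H) ⟩
    n H + (n G ∸ 1)                 ∎
    where open ≡-Reasoning

  hub∈otherHubs∪copy : ∀ {u i} → i ≢ u → enc (inj₁ i) ∈ otherHubs∪copy u
  hub∈otherHubs∪copy {u} i≢u =
    Equivalence.from (hub∈coronaSubset⇔ (∁ ⁅ u ⁆) ⁅ u ⁆) (x∉p⇒x∈∁p (x≢y⇒x∉⁅y⁆ i≢u))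

  copy∈otherHubs∪copy : ∀ u {h} → enc (inj₂ (u , h)) ∈ otherHubs∪copy u
  copy∈otherHubs∪copy u = Equivalence.from (copy∈coronaSubset⇔ (∁ ⁅ u ⁆) ⁅ u ⁆) (x∈⁅x⁆ u)

  hub∉otherHubs∪copy⇒≡ : ∀ u {i} → enc (inj₁ i) ∉ otherHubs∪copy u → i ≡ u
  hub∉otherHubs∪copy⇒≡ u {i} hub∉S with i ≟ u
  ... | yes i≡u = i≡u
  ... | no i≢u = contradiction (hub∈otherHubs∪copy i≢u) hub∉S

  copy∉otherHubs∪copy⇒≢ : ∀ u {i h} → enc (inj₂ (i , h)) ∉ otherHubs∪copy u → i ≢ u
  copy∉otherHubs∪copy⇒≢ u copy∉S refl = copy∉S (copy∈otherHubs∪copy u)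

  module _ {u : Fin (n G)} (u-universal : IsUniversal G u) where

    allHubs-equalizes : (∀ v → 1 < deg G v) → Equalizes allHubs
    allHubs-equalizes _ (inj₁ i) _ _ hub∉S _ = contradiction hub∈allHubs hub∉S
    allHubs-equalizes _ (inj₂ _) (inj₁ j) _ _ hub∉S = contradiction hub∈allHubs hub∉S
    allHubs-equalizes 1<deg (inj₂ (i , _)) (inj₂ (j , _)) _ _ _ with equidistant-vertex G u-universal 1<deg i j
    ... | k , eq = inj₁ k , hub∈allHubs , cong suc eq

    private
      hub[u]-vs-copy : ∀ {j} h → j ≢ u →
        ∃[ w ] (enc w ∈ otherHubs∪copy u × coronaDist w (inj₁ u) ≡ coronaDist w (inj₂ (j , h)))
      hub[u]-vs-copy {j} h j≢u = inj₁ j , hub∈otherHubs∪copy j≢u ,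
        trans (coneDist-adjacent G (universal⇒adjacent G u-universal j≢u)) (cong suc (sym (coneDist-self G j)))

      copy[u]-to-other-copy : ∀ {k} h₀ h → k ≢ u → coronaDist (inj₂ (u , h₀)) (inj₂ (k , h)) ≡ 3
      copy[u]-to-other-copy {k} h₀ h k≢u =
        trans (coronaDist-other-copy h₀ h (≢-sym k≢u)) (cong (2 +_) (coneDist-adjacent G (u-universal k k≢u)))

    otherHubs∪copy-equalizes : Fin (n H) → Equalizes (otherHubs∪copy u)
    otherHubs∪copy-equalizes _ (inj₁ i) (inj₁ j) p≢q p∉S q∉S =
      contradiction (cong inj₁ (trans (hub∉otherHubs∪copy⇒≡ u p∉S) (sym (hub∉otherHubs∪copy⇒≡ u q∉S)))) p≢q
    otherHubs∪copy-equalizes _ (inj₁ i) (inj₂ (j , h)) _ p∉S q∉S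
      rewrite hub∉otherHubs∪copy⇒≡ u p∉S = hub[u]-vs-copy h (copy∉otherHubs∪copy⇒≢ u q∉S)
    otherHubs∪copy-equalizes _ (inj₂ (i , h)) (inj₁ j) _ p∉S q∉S
      rewrite hub∉otherHubs∪copy⇒≡ u q∉S = map₂ (map₂ sym) (hub[u]-vs-copy h (copy∉otherHubs∪copy⇒≢ u p∉S))
    otherHubs∪copy-equalizes h₀ (inj₂ (i , h)) (inj₂ (j , h′)) _ p∉S q∉S with i ≟ j
    ... | yes refl = inj₁ i , hub∈otherHubs∪copy (copy∉otherHubs∪copy⇒≢ u p∉S) , refl
    ... | no _ = inj₂ (u , h₀) , copy∈otherHubs∪copy u ,
      trans (copy[u]-to-other-copy h₀ h (copy∉otherHubs∪copy⇒≢ u p∉S))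
            (sym (copy[u]-to-other-copy h₀ h′ (copy∉otherHubs∪copy⇒≢ u q∉S)))

    private
      equalizer⇒meets-every-block : Fin (n H) → ∀ {S} → IsDistEqualizer (corona G H) S → MeetsEveryBlock S
      equalizer⇒meets-every-block h₀ {S} =
        equalizer-meets-every-block h₀ ∘ Equivalence.to (IsDistEqualizer⇔Equalizes u-universal S)

    ξ≡n[G] : Fin (n H) → (∀ v → 1 < deg G v) → IsXi (corona G H) (n G)
    ξ≡n[G] h₀ 1<deg =
      (allHubs , Equivalence.from (IsDistEqualizer⇔Equalizes u-universal allHubs) (allHubs-equalizes 1<deg) , ∣allHubs∣) ,
      λ S → meets-every-block⇒n≤∣S∣ ∘ equalizer⇒meets-every-block h₀

    ξ≡n[H]+n[G]∸1 : Fin (n H) → ∀ {ℓ} → ℓ ≢ u → (∀ j → adj G ℓ j ≡ true → j ≡ u) →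
      IsXi (corona G H) (n H + n G ∸ 1)
    ξ≡n[H]+n[G]∸1 h₀ ℓ≢u ℓ-leaf =
      subst (IsXi (corona G H)) (sym (+-∸-assoc (n H) (>-nonZero⁻¹ (n G) {{Finₚ.nonZeroIndex u}})))
        ((otherHubs∪copy u , equalizer , ∣otherHubs∪copy∣ u) , lower)
      where
      equalizer : IsDistEqualizer (corona G H) (otherHubs∪copy u)
      equalizer = Equivalence.from (IsDistEqualizer⇔Equalizes u-universal _) (otherHubs∪copy-equalizes h₀)
      lower : ∀ S → IsDistEqualizer (corona G H) S → n H + (n G ∸ 1) ≤ ∣ S ∣
      lower S S-equalizer =
        [ meets-every-block∧copy⊆⇒≤∣S∣ meets , meets-every-block∧copy⊆⇒≤∣S∣ meets ]′
          (equalizer-contains-leaf-copy u-universal ℓ≢u ℓ-leaf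
            (Equivalence.to (IsDistEqualizer⇔Equalizes u-universal S) S-equalizer))
        where
        meets : MeetsEveryBlock S
        meets = equalizer⇒meets-every-block h₀ S-equalizer

proposition37 : (G H : Graph) → 1 ≤ n H → maxDeg G ≡ n G ∸ 1 →
    (2 ≤ minDeg G → IsXi (corona G H) (n G)) ×
    (minDeg G ≡ 1 → IsXi (corona G H) (n H + n G ∸ 1))
proposition37 G H 0<nH Δ≡n∸1 = δ≥2-case , δ≡1-case
  where
  open Corona G H

  h₀ : Fin (n H)
  h₀ = Fin.fromℕ< 0<nH

  universal-vertex : 0 < minDeg G → ∃[ u ] (IsUniversal G u × ∀ v → deg G v ≤ deg G u)
  universal-vertex 0<δ = maxDeg≡n∸1⇒universal-vertex G (vertex-of-0<minDeg G 0<δ) Δ≡n∸1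

  δ≥2-case : 2 ≤ minDeg G → IsXi (corona G H) (n G)
  δ≥2-case 2≤δ with universal-vertex (≤-trans (s≤s z≤n) 2≤δ)
  ... | u , u-universal , _ = ξ≡n[G] u-universal h₀ (λ v → ≤-trans 2≤δ (minDeg≤deg G v))

  δ≡1-case : minDeg G ≡ 1 → IsXi (corona G H) (n H + n G ∸ 1)
  δ≡1-case δ≡1 with universal-vertex (≤-reflexive (sym δ≡1))
  ... | u , u-universal , u-maximal with minDeg-attained G u
  ... | ℓ₀ , deg≡δ with leaf-beside-universal G u-universal u-maximal (trans deg≡δ δ≡1)
  ... | ℓ , ℓ≢u , ℓ-leaf = ξ≡n[H]+n[G]∸1 u-universal h₀ ℓ≢u ℓ-leaf
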